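{- For all integers $k\ge 3$ and $n\ge 1$, the cycle chain $\mathcal{C}_k^n$ is odd prime.
   Context: All graphs are finite and simple. An odd prime labeling of a graph $G$ with $N$ vertices is a bijection $\ell:V(G)\to\{1,3,\dots,2N-1\}$ such that $\gcd(\ell(u),\ell(v))=1$ for every edge $uv$; $G$ is odd prime if it has one. The cycle chain $\mathcal{C}_k^n$ has vertices $v_1,\dots,v_{n+1}$ and, for each $i=1,\dots,n$, two internally disjoint paths between $v_i$ and $v_{i+1}$ using new internal vertices: if $k$ is even, the paths $v_i,w_{i,1},\dots,w_{i,k/2-1},v_{i+1}$ and $v_i,x_{i,1},\dots,x_{i,k/2-1},v_{i+1}$; if $k$ is odd, the paths $v_i,w_{i,1},\dots,w_{i,(k-1)/2-1},v_{i+1}$ and $v_i,x_{i,1},\dots,x_{i,(k-1)/2},v_{i+1}$ (when $k=3$ the first path is the single edge $v_iv_{i+1}$). Thus the two paths between $v_i$ and $v_{i+1}$ form a cycle of length $k$, and consecutive cycles share exactly one vertex. -}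

module Defs where

open import Level using (Level; 0ℓ)
open import Data.Nat using (ℕ; zero; suc; _+_; _*_; _∸_; _/_; _%_)
open import Data.Nat.GCD using (gcd)
open import Data.Fin using (Fin; toℕ; inject₁)
import Data.Fin as Fin
open import Data.Product using (Σ; _×_; _,_)
open import Function.Bundles using (Bijection)
open import Relation.Binary.PropositionalEquality using (_≡_)

-- A (finite simple) graph given by a vertex type and an adjacency relation;
-- finiteness is enforced by the labeling being a bijection onto Fin N.
record Graph : Set₁ where
  field
    V   : Set
    Adj : V → V → Set

oddLabel : {N : ℕ} → Fin N → ℕ
oddLabel i = suc (2 * toℕ i)

-- G is odd prime: there is a bijection ℓ : V(G) → {1,3,…,2N-1} (N = |V(G)|,
-- encoded as a bijection onto Fin N composed with i ↦ 2i+1) with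
-- gcd(ℓ u, ℓ v) = 1 for every edge uv.
OddPrime : Graph → Set
OddPrime G = Σ ℕ λ N → Σ (Bijection (≡-setoid V) (≡-setoid (Fin N))) λ ℓ →
    ∀ u v → Adj u v → gcd (oddLabel (Bijection.to ℓ u)) (oddLabel (Bijection.to ℓ v)) ≡ 1
  where
  open Graph G
  open import Relation.Binary.PropositionalEquality using () renaming (setoid to ≡-setoid)

-- number of internal vertices w_{i,·} and x_{i,·} of each segment
lenW : ℕ → ℕ
lenW k with k % 2
... | zero  = k / 2 ∸ 1
... | suc _ = (k ∸ 1) / 2 ∸ 1

lenX : ℕ → ℕ
lenX k with k % 2
... | zero  = k / 2 ∸ 1
... | suc _ = (k ∸ 1) / 2

-- vertices of the cycle chain C_k^n:
--   hub i     = v_{i+1}        (i < n+1)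
--   wv i j    = w_{i+1,j+1}    (i < n, j < lenW k)
--   xv i j    = x_{i+1,j+1}    (i < n, j < lenX k)
data CVert (k n : ℕ) : Set where
  hub : Fin (suc n) → CVert k n
  wv  : Fin n → Fin (lenW k) → CVert k n
  xv  : Fin n → Fin (lenX k) → CVert k n

-- consecutive vertices along the paths v_i,w_{i,1},…,v_{i+1} and v_i,x_{i,1},…,v_{i+1}
data Arc (k n : ℕ) : CVert k n → CVert k n → Set where
  w-start  : ∀ i j → toℕ j ≡ 0 → Arc k n (hub (inject₁ i)) (wv i j)
  w-step   : ∀ i j j' → suc (toℕ j) ≡ toℕ j' → Arc k n (wv i j) (wv i j')
  w-end    : ∀ i j → suc (toℕ j) ≡ lenW k → Arc k n (wv i j) (hub (Fin.suc i))
  w-direct : ∀ i → lenW k ≡ 0 → Arc k n (hub (inject₁ i)) (hub (Fin.suc i))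
  x-start  : ∀ i j → toℕ j ≡ 0 → Arc k n (hub (inject₁ i)) (xv i j)
  x-step   : ∀ i j j' → suc (toℕ j) ≡ toℕ j' → Arc k n (xv i j) (xv i j')
  x-end    : ∀ i j → suc (toℕ j) ≡ lenX k → Arc k n (xv i j) (hub (Fin.suc i))
  x-direct : ∀ i → lenX k ≡ 0 → Arc k n (hub (inject₁ i)) (hub (Fin.suc i))

data CAdj (k n : ℕ) (u v : CVert k n) : Set where
  fwd : Arc k n u v → CAdj k n u v
  bwd : Arc k n v u → CAdj k n u v

CycleChain : ℕ → ℕ → Graph
CycleChain k n = record { V = CVert k n ; Adj = CAdj k n }

{-# OPTIONS --safe #-}
module Submission where

-- Number the vertices segment by segment: segment i starts with the hub v_i,
-- followed by the internal vertices of its two paths interleaved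
-- (x_1, w_1, x_2, w_2, …), and v_{i+1} opens the next segment. Since the two
-- paths of a segment differ in length by at most one, adjacent vertices get
-- numbers at distance 1 or 2. Labelling the vertex numbered m by 2m + 1, adjacent
-- labels are odd and differ by 2 or 4, hence are coprime.

open import Defs
open import Data.Nat
  using (ℕ; zero; suc; _+_; _*_; _∸_; _≤_; _<_; z≤n; s≤s; s≤s⁻¹; _/_; _%_; NonZero)
open import Data.Nat.Properties
open import Data.Nat.GCD using (gcd)
open import Data.Nat.Coprimality using (Coprime; coprime⇒gcd≡1)
import Data.Nat.Coprimality as Coprime
open import Data.Nat.Divisibility
  using (_∣_; divides; ∣-trans; ∣m+n∣m⇒∣n; ∣⇒≤; 0∣⇒≡0; n∣m⇒m%n≡0)
open import Data.Nat.DivMod using (m≡m%n+[m/n]*n; m%n<n; [m+kn]%n≡m%n; m<n⇒m%n≡m; %-congˡ)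
open import Data.Fin using (Fin; toℕ; fromℕ<)
import Data.Fin as Fin
open import Data.Fin.Properties using (toℕ-injective; toℕ-fromℕ<; toℕ-inject₁; toℕ<n)
open import Data.Product using (∃; _×_; _,_; map₂)
open import Data.Sum using (_⊎_; inj₁; inj₂)
open import Relation.Nullary using (¬_; contradiction)
open import Relation.Binary.PropositionalEquality
open import Function.Bundles using (_⤖_; mk⤖)
open import Function.Consequences.Propositional using (strictlySurjective⇒surjective)

2∤odd : ∀ m → ¬ 2 ∣ suc (2 * m)
2∤odd m (divides q eq) = even≢odd q m (sym (trans eq (*-comm q 2)))

odd∣4⇒≡1 : ∀ {d} m → d ∣ 4 → d ∣ suc (2 * m) → d ≡ 1
odd∣4⇒≡1 {0} m d∣4 _ = contradiction (0∣⇒≡0 d∣4) λ ()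
odd∣4⇒≡1 {1} m _ _ = refl
odd∣4⇒≡1 {2} m _ 2∣odd = contradiction 2∣odd (2∤odd m)
odd∣4⇒≡1 {3} m 3∣4 _ = contradiction (n∣m⇒m%n≡0 4 3 3∣4) λ ()
odd∣4⇒≡1 {4} m _ 4∣odd = contradiction (∣-trans (divides 2 refl) 4∣odd) (2∤odd m)
odd∣4⇒≡1 {suc (suc (suc (suc (suc d))))} m d∣4 _ =
  contradiction (∣⇒≤ d∣4) λ { (s≤s (s≤s (s≤s (s≤s ())))) }

coprime-odd-+ : ∀ c m → c ∣ 4 → Coprime (suc (2 * m)) (c + suc (2 * m))
coprime-odd-+ c m c∣4 {d} (d∣odd , d∣c+odd) =
  odd∣4⇒≡1 m (∣-trans (∣m+n∣m⇒∣n (subst (d ∣_) (+-comm c _) d∣c+odd) d∣odd) c∣4) d∣odd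

Close : ℕ → ℕ → Set
Close m n = n ≡ 1 + m ⊎ n ≡ 2 + m

Near : ℕ → ℕ → Set
Near m n = Close m n ⊎ Close n m

Close-+ˡ : ∀ {m n} t → Close m n → Close (t + m) (t + n)
Close-+ˡ {m} t (inj₁ refl) = inj₁ (+-suc t m)
Close-+ˡ {m} t (inj₂ refl) = inj₂ (trans (+-suc t (suc m)) (cong suc (+-suc t m)))

coprime-odd-close : ∀ {m n} → Close m n → Coprime (suc (2 * m)) (suc (2 * n))
coprime-odd-close {m} (inj₁ refl) =
  subst (Coprime _) (cong suc (sym (*-suc 2 m))) (coprime-odd-+ 2 m (divides 2 refl))
coprime-odd-close {m} (inj₂ refl) =
  subst (Coprime _) (cong suc (sym (trans (*-suc 2 (suc m)) (cong (2 +_) (*-suc 2 m)))))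
    (coprime-odd-+ 4 m (divides 1 refl))

coprime-odd-near : ∀ {m n} → Near m n → Coprime (suc (2 * m)) (suc (2 * n))
coprime-odd-near (inj₁ close) = coprime-odd-close close
coprime-odd-near (inj₂ close) = Coprime.sym (coprime-odd-close close)

numbering⇒⤖Fin : ∀ {A : Set} {N} (number : A → ℕ) (number< : ∀ x → number x < N) →
                 (∀ {x y} → number x ≡ number y → x ≡ y) →
                 (∀ m → m < N → ∃ λ x → number x ≡ m) →
                 A ⤖ Fin N
numbering⇒⤖Fin {A} {N} number number< injective surjective =
  mk⤖ (injective′ , strictlySurjective⇒surjective surjective′)
  where
  label : A → Fin N
  label x = fromℕ< (number< x)
  injective′ : ∀ {x y} → label x ≡ label y → x ≡ y
  injective′ {x} {y} eq =
    injective (trans (sym (toℕ-fromℕ< (number< x))) (trans (cong toℕ eq) (toℕ-fromℕ< (number< y))))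
  surjective′ : ∀ i → ∃ λ x → label x ≡ i
  surjective′ i with surjective (toℕ i) (toℕ<n i)
  ... | x , eq = x , toℕ-injective (trans (toℕ-fromℕ< (number< x)) eq)

numbering⇒oddPrime : ∀ (G : Graph) N (number : Graph.V G → ℕ) (number< : ∀ v → number v < N) →
                     (∀ {u v} → number u ≡ number v → u ≡ v) →
                     (∀ m → m < N → ∃ λ v → number v ≡ m) →
                     (∀ {u v} → Graph.Adj G u v → Near (number u) (number v)) →
                     OddPrime G
numbering⇒oddPrime G N number number< injective surjective near =
  N , numbering⇒⤖Fin number number< injective surjective , coprime
  where
  coprime : ∀ u v → Graph.Adj G u v →
            gcd (oddLabel (fromℕ< (number< u))) (oddLabel (fromℕ< (number< v))) ≡ 1
  coprime u v uv rewrite toℕ-fromℕ< (number< u) | toℕ-fromℕ< (number< v) =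
    coprime⇒gcd≡1 (coprime-odd-near (near uv))

divMod-unique : ∀ {d q q′ r r′} .{{_ : NonZero d}} → r < d → r′ < d →
                q * d + r ≡ q′ * d + r′ → q ≡ q′ × r ≡ r′
divMod-unique {d} {q} {q′} {r} {r′} r<d r′<d eq = q≡q′ , r≡r′
  where
  remainder : ∀ q r → r < d → (q * d + r) % d ≡ r
  remainder q r r<d =
    trans (%-congˡ (+-comm (q * d) r)) (trans ([m+kn]%n≡m%n r q d) (m<n⇒m%n≡m r<d))
  r≡r′ : r ≡ r′
  r≡r′ = trans (sym (remainder q r r<d)) (trans (cong (_% d) eq) (remainder q′ r′ r′<d))
  q≡q′ : q ≡ q′
  q≡q′ = *-cancelʳ-≡ q q′ d
    (+-cancelʳ-≡ r (q * d) (q′ * d) (trans eq (cong (q′ * d +_) (sym r≡r′))))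

q*d+r<n*d : ∀ {q r n d} → q < n → r < d → q * d + r < n * d
q*d+r<n*d {q} {r} {n} {d} q<n r<d = begin-strict
  q * d + r <⟨ +-monoʳ-< (q * d) r<d ⟩
  q * d + d ≡⟨ +-comm (q * d) d ⟩
  suc q * d ≤⟨ *-monoˡ-≤ d q<n ⟩
  n * d     ∎
  where open ≤-Reasoning

data Parity : ℕ → Set where
  even : ∀ j → Parity (2 * j)
  odd  : ∀ j → Parity (suc (2 * j))

parity : ∀ m → Parity m
parity zero = even 0
parity (suc m) with parity m
... | even j = odd j
... | odd j  = subst Parity (*-suc 2 j) (even (suc j))

Balanced : ℕ → ℕ → Set
Balanced a b = b ≡ a ⊎ b ≡ suc a

lenX-balanced : ∀ k → Balanced (lenW k) (lenX k)
lenX-balanced k with k % 2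
... | zero = inj₁ refl
... | suc _ with (k ∸ 1) / 2
...   | zero  = inj₁ refl
...   | suc _ = inj₂ refl

balanced⇒≤ : ∀ {a b} → Balanced a b → a ≤ b
balanced⇒≤ (inj₁ refl) = ≤-refl
balanced⇒≤ (inj₂ refl) = n≤1+n _

balanced⇒≤suc : ∀ {a b} → Balanced a b → b ≤ suc a
balanced⇒≤suc (inj₁ refl) = n≤1+n _
balanced⇒≤suc (inj₂ refl) = ≤-refl

wOffset xOffset : ℕ → ℕ
wOffset j = 2 + 2 * j
xOffset j = 1 + 2 * j

2*m≡m+m : ∀ m → 2 * m ≡ m + m
2*m≡m+m m = cong (m +_) (+-identityʳ m)

module _ {a b : ℕ} (balanced : Balanced a b) where
  open ≤-Reasoning

  wOffset< : ∀ {j} → j < a → wOffset j < suc (a + b)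
  wOffset< {j} j<a = s≤s (begin
    2 + 2 * j ≡⟨ *-suc 2 j ⟨
    2 * suc j ≤⟨ *-monoʳ-≤ 2 j<a ⟩
    2 * a     ≡⟨ 2*m≡m+m a ⟩
    a + a     ≤⟨ +-monoʳ-≤ a (balanced⇒≤ balanced) ⟩
    a + b     ∎)

  xOffset< : ∀ {j} → j < b → xOffset j < suc (a + b)
  xOffset< {j} j<b = s≤s (s≤s⁻¹ (begin
    2 + 2 * j   ≡⟨ *-suc 2 j ⟨
    2 * suc j   ≤⟨ *-monoʳ-≤ 2 j<b ⟩
    2 * b       ≡⟨ 2*m≡m+m b ⟩
    b + b       ≤⟨ +-monoˡ-≤ b (balanced⇒≤suc balanced) ⟩
    suc (a + b) ∎))

  wOffset<⇒ : ∀ {j} → wOffset j < suc (a + b) → j < a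
  wOffset<⇒ {j} bound = *-cancelˡ-< 2 j a (s≤s⁻¹ (begin
    2 + 2 * j   ≤⟨ s≤s⁻¹ bound ⟩
    a + b       ≤⟨ +-monoʳ-≤ a (balanced⇒≤suc balanced) ⟩
    a + suc a   ≡⟨ +-suc a a ⟩
    suc (a + a) ≡⟨ cong suc (2*m≡m+m a) ⟨
    suc (2 * a) ∎))

  xOffset<⇒ : ∀ {j} → xOffset j < suc (a + b) → j < b
  xOffset<⇒ {j} bound = *-cancelˡ-< 2 j b (begin
    1 + 2 * j ≤⟨ s≤s⁻¹ bound ⟩
    a + b     ≤⟨ +-monoˡ-≤ b (balanced⇒≤ balanced) ⟩
    b + b     ≡⟨ 2*m≡m+m b ⟨
    2 * b     ∎)

w-step-close : ∀ j → Close (wOffset j) (wOffset (suc j))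
w-step-close j = inj₂ (cong (2 +_) (*-suc 2 j))

x-step-close : ∀ j → Close (xOffset j) (xOffset (suc j))
x-step-close j = inj₂ (cong (1 +_) (*-suc 2 j))

m+1+m≡1+2*m : ∀ m → m + suc m ≡ suc (2 * m)
m+1+m≡1+2*m m = trans (+-suc m m) (cong suc (sym (2*m≡m+m m)))

w-end-close : ∀ {a b j} → suc j ≡ a → Balanced a b → Close (wOffset j) (suc (a + b))
w-end-close {j = j} refl (inj₁ refl) = inj₁ (cong (2 +_) (m+1+m≡1+2*m j))
w-end-close {j = j} refl (inj₂ refl) =
  inj₂ (cong (2 +_) (trans (+-suc j (suc j)) (cong suc (m+1+m≡1+2*m j))))

x-end-close : ∀ {a b j} → suc j ≡ b → Balanced a b → Close (xOffset j) (suc (a + b))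
x-end-close {j = j} refl (inj₁ refl) = inj₂ (cong (2 +_) (m+1+m≡1+2*m j))
x-end-close {j = j} refl (inj₂ refl) = inj₁ (cong suc (m+1+m≡1+2*m j))

w-direct-close : ∀ {a b} → a ≡ 0 → Balanced a b → Close 0 (suc (a + b))
w-direct-close refl (inj₁ refl) = inj₁ refl
w-direct-close refl (inj₂ refl) = inj₂ refl

x-direct-close : ∀ {a b} → b ≡ 0 → Balanced a b → Close 0 (suc (a + b))
x-direct-close refl (inj₁ refl) = inj₁ refl

module CycleChainNumbering (k n : ℕ) where
  a b d : ℕ
  a = lenW k
  b = lenX k
  d = suc (a + b)

  balanced : Balanced a b
  balanced = lenX-balanced k

  segment : CVert k n → ℕ
  segment (hub i)  = toℕ i
  segment (wv i _) = toℕ i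
  segment (xv i _) = toℕ i

  offset : CVert k n → ℕ
  offset (hub _)  = 0
  offset (wv _ j) = wOffset (toℕ j)
  offset (xv _ j) = xOffset (toℕ j)

  number : CVert k n → ℕ
  number v = segment v * d + offset v

  offset<d : ∀ v → offset v < d
  offset<d (hub _)  = s≤s z≤n
  offset<d (wv _ j) = wOffset< balanced (toℕ<n j)
  offset<d (xv _ j) = xOffset< balanced (toℕ<n j)

  number< : ∀ v → number v < suc (n * d)
  number< (hub i)    = s≤s (begin
    toℕ i * d + 0 ≡⟨ +-identityʳ _ ⟩
    toℕ i * d     ≤⟨ *-monoˡ-≤ d (s≤s⁻¹ (toℕ<n i)) ⟩
    n * d         ∎)
    where open ≤-Reasoning
  number< v@(wv i _) = m<n⇒m<1+n (q*d+r<n*d (toℕ<n i) (offset<d v))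
  number< v@(xv i _) = m<n⇒m<1+n (q*d+r<n*d (toℕ<n i) (offset<d v))

  segment-offset-injective : ∀ {u v} → segment u ≡ segment v → offset u ≡ offset v → u ≡ v
  segment-offset-injective {hub _}  {hub _}  s≡ _  = cong hub (toℕ-injective s≡)
  segment-offset-injective {wv _ j} {wv _ j′} s≡ o≡ = cong₂ wv (toℕ-injective s≡)
    (toℕ-injective (*-cancelˡ-≡ (toℕ j) (toℕ j′) 2 (suc-injective (suc-injective o≡))))
  segment-offset-injective {xv _ j} {xv _ j′} s≡ o≡ = cong₂ xv (toℕ-injective s≡)
    (toℕ-injective (*-cancelˡ-≡ (toℕ j) (toℕ j′) 2 (suc-injective o≡)))
  segment-offset-injective {wv _ j} {xv _ j′} _ o≡ =
    contradiction (sym (suc-injective o≡)) (even≢odd (toℕ j′) (toℕ j))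
  segment-offset-injective {xv _ j} {wv _ j′} _ o≡ =
    contradiction (suc-injective o≡) (even≢odd (toℕ j) (toℕ j′))
  segment-offset-injective {hub _}  {wv _ _} _ ()
  segment-offset-injective {hub _}  {xv _ _} _ ()
  segment-offset-injective {wv _ _} {hub _}  _ ()
  segment-offset-injective {xv _ _} {hub _}  _ ()

  number-injective : ∀ {u v} → number u ≡ number v → u ≡ v
  number-injective {u} {v} eq with divMod-unique (offset<d u) (offset<d v) eq
  ... | s≡ , o≡ = segment-offset-injective s≡ o≡

  locate-interior : ∀ q {s} → Parity s → suc s < d → q < n →
                    ∃ λ v → number v ≡ q * d + suc s
  locate-interior q (even j) r<d q<n = xv (fromℕ< q<n) (fromℕ< j<b) ,
    cong₂ (λ i j → i * d + xOffset j) (toℕ-fromℕ< q<n) (toℕ-fromℕ< j<b)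
    where
    j<b : j < b
    j<b = xOffset<⇒ balanced r<d
  locate-interior q (odd j) r<d q<n = wv (fromℕ< q<n) (fromℕ< j<a) ,
    cong₂ (λ i j → i * d + wOffset j) (toℕ-fromℕ< q<n) (toℕ-fromℕ< j<a)
    where
    j<a : j < a
    j<a = wOffset<⇒ balanced r<d

  locate : ∀ q r → r < d → q * d + r < suc (n * d) → ∃ λ v → number v ≡ q * d + r
  locate q zero _ bound = hub (fromℕ< q<1+n) , cong (λ i → i * d + 0) (toℕ-fromℕ< q<1+n)
    where
    q<1+n : q < suc n
    q<1+n = s≤s (*-cancelʳ-≤ q n d (subst (_≤ n * d) (+-identityʳ (q * d)) (s≤s⁻¹ bound)))
  locate q (suc s) r<d bound = locate-interior q (parity s) r<d q<n
    where
    q<n : q < n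
    q<n = *-cancelʳ-< d q n (<-≤-trans (m<m+n (q * d) (s≤s z≤n)) (s≤s⁻¹ bound))

  number-surjective : ∀ m → m < suc (n * d) → ∃ λ v → number v ≡ m
  number-surjective m m<N =
    map₂ (λ eq → trans eq quotRem)
      (locate (m / d) (m % d) (m%n<n m d) (subst (_< suc (n * d)) (sym quotRem) m<N))
    where
    quotRem : m / d * d + m % d ≡ m
    quotRem = sym (trans (m≡m%n+[m/n]*n m d) (+-comm (m % d) _))

  number-hub-suc : ∀ i → number (hub (Fin.suc i)) ≡ toℕ i * d + d
  number-hub-suc i = trans (+-identityʳ _) (+-comm d _)

  arc-close : ∀ {u v} → Arc k n u v → Close (number u) (number v)
  arc-close (w-start i j j≡0) rewrite toℕ-inject₁ i | j≡0 = Close-+ˡ (toℕ i * d) (inj₂ refl)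
  arc-close (x-start i j j≡0) rewrite toℕ-inject₁ i | j≡0 = Close-+ˡ (toℕ i * d) (inj₁ refl)
  arc-close (w-step i j j′ j′≡) rewrite sym j′≡ = Close-+ˡ (toℕ i * d) (w-step-close (toℕ j))
  arc-close (x-step i j j′ j′≡) rewrite sym j′≡ = Close-+ˡ (toℕ i * d) (x-step-close (toℕ j))
  arc-close (w-end i j last) =
    subst (Close _) (sym (number-hub-suc i)) (Close-+ˡ (toℕ i * d) (w-end-close last balanced))
  arc-close (x-end i j last) =
    subst (Close _) (sym (number-hub-suc i)) (Close-+ˡ (toℕ i * d) (x-end-close last balanced))
  arc-close (w-direct i empty) rewrite toℕ-inject₁ i =
    subst (Close _) (sym (number-hub-suc i)) (Close-+ˡ (toℕ i * d) (w-direct-close empty balanced))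
  arc-close (x-direct i empty) rewrite toℕ-inject₁ i =
    subst (Close _) (sym (number-hub-suc i)) (Close-+ˡ (toℕ i * d) (x-direct-close empty balanced))

  adjacent-near : ∀ {u v} → CAdj k n u v → Near (number u) (number v)
  adjacent-near (fwd arc) = inj₁ (arc-close arc)
  adjacent-near (bwd arc) = inj₂ (arc-close arc)

-- The numbering works for all k and n.
mainTheorem3 : ∀ (k n : ℕ) → 3 ≤ k → 1 ≤ n → OddPrime (CycleChain k n)
mainTheorem3 k n _ _ =
  numbering⇒oddPrime (CycleChain k n) (suc (n * d))
    number number< number-injective number-surjective adjacent-near
  where open CycleChainNumbering k n
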